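{- Let $\mathcal C$ be a countable collection of languages over a countably infinite universe $U$. Then $\mathcal C$ is generatable in the limit without samples if and only if $\bigl|\bigcap_{L\in\mathcal C'}L\bigr|=\infty$ for every finite $\mathcal C'\subseteq\mathcal C$.
   Context: A language is an infinite subset of $U$. A generator without samples is an injection $G:\mathbb N\to U$, with output $z_t=G(t)$. $G$ generates in the limit without samples for $\mathcal C$ if for every $K\in\mathcal C$ there exists $t^\star$ such that $z_t\in K$ for all $t\ge t^\star$; $\mathcal C$ is generatable in the limit without samples if such $G$ exists. -}

module Defs where

open import Data.Nat using (ℕ; _≥_)
open import Data.List using (List)
open import Data.List.Membership.Propositional using (_∈_; _∉_)
open import Data.Maybe using (Maybe; just; nothing)
open import Data.Unit using (⊤)
open import Data.Product using (Σ; ∃; _×_)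
open import Relation.Binary.PropositionalEquality using (_≡_)
open import Function.Definitions using (Injective)

Subset : Set → Set₁
Subset U = U → Set

IsInfinite : {U : Set} → Subset U → Set
IsInfinite {U} P = (xs : List U) → ∃ λ x → P x × x ∉ xs

Language : Set → Set₁
Language U = Σ (Subset U) IsInfinite

_∈L_ : {U : Set} → U → Language U → Set
x ∈L L = Σ.proj₁ L x
  where open Data.Product

-- A countable collection of languages is given by an enumeration
-- C : ℕ → Maybe (Language U); its members are the L with C n ≡ just L
-- for some n (the "nothing" entries allow finite and empty collections).
Collection : Set → Set₁
Collection U = ℕ → Maybe (Language U)

-- A finite subcollection C' ⊆ C is given by a finite list of indices.
-- Membership in ⋂_{L ∈ C'} L.
-- (An index n with C n ≡ nothing contributes no constraint.)
_∈M_ : {U : Set} → U → Maybe (Language U) → Set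
x ∈M nothing = ⊤
x ∈M just L = x ∈L L

InterSub : {U : Set} → Collection U → List ℕ → Subset U
InterSub C ns x = ∀ n → n ∈ ns → x ∈M C n

GeneratesInLimit : {U : Set} → (ℕ → U) → Collection U → Set₁
GeneratesInLimit G C =
  ∀ n L → C n ≡ just L → ∃ λ tstar → ∀ t → t ≥ tstar → G t ∈L L

Generatable : {U : Set} → Collection U → Set₁
Generatable {U} C = ∃ λ (G : ℕ → U) → Injective _≡_ _≡_ G × GeneratesInLimit G C

-- An injective generator that eventually lies in each member of C eventually lies in any
-- finite intersection, and being injective it leaves every finite list, so each finite
-- intersection is infinite. Conversely, if every finite intersection is infinite, at
-- time t pick an element of the intersection of the first t + 1 members of C that has
-- not been output before; the result is injective and, from time n on, lies in C n.
module Submission where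

open import Defs
open import Data.Nat using (ℕ; zero; suc; _≤_; _<_; _≥_; _⊔_; s≤s)
open import Data.Nat.Properties using (≤-refl; ≤-trans; n≤1+n; m≤m⊔n; m≤n⊔m; <-cmp; <-irrefl; m≤n⇒m<n∨m≡n; eq?)
open import Data.List using (List; []; _∷_; upTo)
open import Data.List.Membership.Propositional using (_∈_; _∉_)
open import Data.List.Membership.Propositional.Properties using (∈-upTo⁺)
open import Data.List.Relation.Unary.Any using (here; there)
open import Data.Maybe using (just; nothing)
open import Data.Unit using (tt)
open import Data.Empty using (⊥-elim)
open import Data.Product using (∃; _×_; _,_; proj₁; proj₂)
open import Data.Sum using (inj₁; inj₂)
open import Relation.Nullary using (yes; no)
open import Relation.Binary using (tri<; tri≈; tri>)
open import Relation.Binary.Definitions using (DecidableEquality)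
open import Relation.Binary.PropositionalEquality using (_≡_; refl; sym; subst)
open import Function.Bundles using (_⤖_; _⇔_; mk⇔)
open import Function.Definitions using (Injective)
open import Function.Properties.Bijection using (⤖⇒↔)
open import Function.Properties.Inverse using (↔-sym; ↔⇒↣)

Eventually : (ℕ → Set) → Set
Eventually P = ∃ λ T → ∀ t → t ≥ T → P t

eventually-∀∈ : {A : Set} {P : A → ℕ → Set} →
  (∀ a → Eventually (P a)) → (as : List A) → Eventually (λ t → ∀ a → a ∈ as → P a t)
eventually-∀∈ ev [] = 0 , λ _ _ _ ()
eventually-∀∈ ev (a ∷ as) with ev a | eventually-∀∈ ev as
... | T , p | T′ , p′ = T ⊔ T′ , λ where
  t t≥ _ (here refl) → p t (≤-trans (m≤m⊔n T T′) t≥)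
  t t≥ b (there b∈) → p′ t (≤-trans (m≤n⊔m T T′) t≥) b b∈

module _ {U : Set} (_≟_ : DecidableEquality U) {G : ℕ → U} (G-inj : Injective _≡_ _≡_ G) where

  injective-escapes : (xs : List U) → ∀ T → ∃ λ t → t ≥ T × G t ∉ xs
  injective-escapes [] T = T , ≤-refl , λ ()
  injective-escapes (x ∷ xs) T with injective-escapes xs T
  ... | t , t≥T , t∉ with G t ≟ x
  ...   | no Gt≢x = t , t≥T , λ where
    (here Gt≡x) → Gt≢x Gt≡x
    (there Gt∈) → t∉ Gt∈
  ...   | yes refl with injective-escapes xs (suc t)
  ...     | t′ , t′>t , t′∉ = t′ , ≤-trans t≥T (≤-trans (n≤1+n t) t′>t) , λ where
    (here Gt′≡Gt) → <-irrefl (sym (G-inj Gt′≡Gt)) t′>t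
    (there Gt′∈) → t′∉ Gt′∈

  eventually-injective⇒infinite : {P : Subset U} → Eventually (λ t → P (G t)) → IsInfinite P
  eventually-injective⇒infinite (T , p) xs with injective-escapes xs T
  ... | t , t≥T , t∉ = G t , p t t≥T , t∉

module DistinctChoice {U : Set} (P : ℕ → Subset U) (P-infinite : ∀ t → IsInfinite (P t)) where

  chosen : ℕ → U
  previous : ℕ → List U

  chosen t = proj₁ (P-infinite t (previous t))

  previous zero = []
  previous (suc t) = chosen t ∷ previous t

  chosen-∈ : ∀ t → P t (chosen t)
  chosen-∈ t = proj₁ (proj₂ (P-infinite t (previous t)))

  chosen-fresh : ∀ t → chosen t ∉ previous t
  chosen-fresh t = proj₂ (proj₂ (P-infinite t (previous t)))

  chosen-∈-previous : ∀ {s t} → s < t → chosen s ∈ previous t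
  chosen-∈-previous {t = suc t} (s≤s s≤t) with m≤n⇒m<n∨m≡n s≤t
  ... | inj₁ s<t = there (chosen-∈-previous s<t)
  ... | inj₂ refl = here refl

  chosen-injective : Injective _≡_ _≡_ chosen
  chosen-injective {s} {t} eq with <-cmp s t
  ... | tri< s<t _ _ = ⊥-elim (chosen-fresh t (subst (_∈ previous t) eq (chosen-∈-previous s<t)))
  ... | tri≈ _ s≡t _ = s≡t
  ... | tri> _ _ s>t = ⊥-elim (chosen-fresh s (subst (_∈ previous s) (sym eq) (chosen-∈-previous s>t)))

module _ {U : Set} (C : Collection U) where

  generates⇒eventually-∈M : {G : ℕ → U} → GeneratesInLimit G C → ∀ n → Eventually (λ t → G t ∈M C n)
  generates⇒eventually-∈M gen n with C n in eq
  ... | nothing = 0 , λ _ _ → tt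
  ... | just L = gen n L eq

  generates⇒eventually-InterSub : {G : ℕ → U} → GeneratesInLimit G C →
    ∀ ns → Eventually (λ t → InterSub C ns (G t))
  generates⇒eventually-InterSub gen = eventually-∀∈ (generates⇒eventually-∈M gen)

  module FromInfiniteIntersections (H : ∀ ns → IsInfinite (InterSub C ns)) where
    open DistinctChoice (λ t → InterSub C (upTo (suc t))) (λ t → H (upTo (suc t))) public

    chosen-generates : GeneratesInLimit chosen C
    chosen-generates n L eq = n , λ t n≤t →
      subst (chosen t ∈M_) eq (chosen-∈ t n (∈-upTo⁺ (s≤s n≤t)))

theorem4p4 : (U : Set) → ℕ ⤖ U → (C : Collection U) →
    Generatable C ⇔ ((ns : List ℕ) → IsInfinite (InterSub C ns))
theorem4p4 U e C = mk⇔ necessary sufficient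
  where
  -- The enumeration of U is needed only to decide equality in U.
  _≟_ : DecidableEquality U
  _≟_ = eq? (↔⇒↣ (↔-sym (⤖⇒↔ e)))

  necessary : Generatable C → ∀ ns → IsInfinite (InterSub C ns)
  necessary (G , G-inj , gen) ns =
    eventually-injective⇒infinite _≟_ G-inj (generates⇒eventually-InterSub C gen ns)

  sufficient : (∀ ns → IsInfinite (InterSub C ns)) → Generatable C
  sufficient H = chosen , chosen-injective , chosen-generates
    where open FromInfiniteIntersections C H
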